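{- Let $k\geq 3$, $1\le t<k$, and $t<d<k$ with $d+t\le k$ and $k$ odd, $t$ even, $d$ even. Let $x\in\{0,1\}^k$ have weight $d$. Then there is an odd $m$ such that $\mathrm{Pol}(\mathbf{I}_{t,k}\cup\{x\},\mathbf{NAE}_k)$ contains no 2-block-symmetric function of arity $m$.
   Context: Weight of a Boolean tuple = number of 1's. $\mathbf{I}_{t,k}\cup\{x\}$: Boolean structure whose single $k$-ary relation is the set of all tuples of weight $t$ together with $x$. $\mathbf{NAE}_k$: Boolean structure with relation $\{0,1\}^k\setminus\{0^k,1^k\}$. A polymorphism of arity $m$ of $(\mathbf{A},\mathbf{B})$ (single $k$-ary relations $R,S$) is $f:\{0,1\}^m\to\{0,1\}$ such that for every $k\times m$ matrix with columns in $R$, applying $f$ row-wise gives a tuple in $S$. A function of arity $2n+1$ is 2-block-symmetric if it is invariant under every permutation of its coordinates that preserves parity of positions. -}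

module Defs where

open import Data.Nat using (ℕ; zero; suc; _+_; _*_)
open import Data.Nat.Properties using ()
open import Data.Bool using (Bool; true; false)
open import Data.Fin using (Fin; toℕ)
import Data.Fin as F
open import Data.Nat.Base using (_%_)
open import Data.Fin.Permutation using (Permutation′; _⟨$⟩ʳ_)
open import Data.Product using (Σ; _×_; ∃)
open import Data.Sum using (_⊎_)
open import Relation.Binary.PropositionalEquality using (_≡_)
open import Relation.Nullary using (¬_)

Tuple : ℕ → Set
Tuple k = Fin k → Bool

Rel : ℕ → Set₁
Rel k = Tuple k → Set

weight : ∀ {k} → Tuple k → ℕ
weight {zero}  x = 0
weight {suc k} x = (if-true (x F.zero)) + weight (λ i → x (F.suc i))
  where
  if-true : Bool → ℕ
  if-true true  = 1
  if-true false = 0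

I∪ : (k t : ℕ) → Tuple k → Rel k
I∪ k t x y = (weight y ≡ t) ⊎ (∀ i → y i ≡ x i)

NAE : (k : ℕ) → Rel k
NAE k y = ¬ (∀ i → y i ≡ false) × ¬ (∀ i → y i ≡ true)

Op : ℕ → Set
Op m = (Fin m → Bool) → Bool

IsPolymorphism : ∀ {k} → Rel k → Rel k → ∀ {m} → Op m → Set
IsPolymorphism {k} R S {m} f =
  (M : Fin k → Fin m → Bool) →
  (∀ (j : Fin m) → R (λ i → M i j)) →
  S (λ i → f (M i))

ParityPreserving : ∀ {m} → Permutation′ m → Set
ParityPreserving {m} σ = ∀ (j : Fin m) → toℕ (σ ⟨$⟩ʳ j) % 2 ≡ toℕ j % 2

TwoBlockSymmetric : ∀ n → Op (suc (2 * n)) → Set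
TwoBlockSymmetric n f =
  (σ : Permutation′ (suc (2 * n))) → ParityPreserving σ →
  ∀ (a : Fin (suc (2 * n)) → Bool) → f (λ j → a (σ ⟨$⟩ʳ j)) ≡ f a

open import Data.Nat.Divisibility using (_∣_)

Even : ℕ → Set
Even n = 2 ∣ n

Odd : ℕ → Set
Odd n = ¬ (2 ∣ n)

-- Let k = n + 1 with n = 2K, and let m = 2n + 1.  A 2-block-symmetric f of arity m only sees how
-- many ones a tuple has on its n + 1 even and on its n odd positions; write g(b) for its value
-- when there are t ones on the even and b on the odd positions.  After permuting coordinates we
-- may take x to be the initial segment of weight d.  For each of the pairs {t, 0}, {2t, 0} and
-- {t, 2t} we build a k × m matrix whose columns lie in I_{t,k} ∪ {x} and whose rows have t ones
-- on the even positions and one of the two odd weights of the pair: its even columns form a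
-- circulant with t ones in every row and column, its odd columns a circulant (shifted or with
-- doubled columns) or t copies of x bordered by a circulant.  Applying f row-wise must give a
-- not-all-equal tuple, so g separates each pair, which is impossible for three Boolean values.
module Submission where

open import Defs
open import Data.Nat using (ℕ; suc; _*_; _+_; _≤_; _<_)
open import Data.Product using (Σ; _×_; ∃-syntax)
open import Relation.Binary.PropositionalEquality using (_≡_)
open import Relation.Nullary using (¬_)

import Algebra.Properties.CommutativeMonoid.Sum as MonoidSum
open import Algebra.Properties.CommutativeSemigroup using (interchange)
open import Data.Bool using (Bool; true; false; not; _∧_; _∨_; if_then_else_)
import Data.Bool as Bool
open import Data.Bool.Properties using (T-≡; ∨-identityʳ)
open import Data.Empty using (⊥; ⊥-elim)
open import Data.Fin using (Fin; zero; suc; toℕ)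
open import Data.Fin.Properties using (toℕ<n)
open import Data.Fin.Permutation
  using (Permutation′; _⟨$⟩ʳ_; _⟨$⟩ˡ_; id; flip; _∘ₚ_; lift₀; transpose; inverseʳ)
open import Data.Nat using (zero; _∸_; z≤n; s≤s; z<s; s<s; _<ᵇ_; _≡ᵇ_; _%_; ⌊_/2⌋; _<?_)
import Data.Nat as Nat
open import Data.Nat.Divisibility using (divides)
open import Data.Nat.Properties
  using ( +-0-commutativeMonoid; +-commutativeSemigroup; +-comm; +-assoc; +-suc; +-identityʳ
        ; +-cancelˡ-≡; *-suc; *-comm; *-cancelˡ-≤; *-cancelˡ-<; suc-injective; <⇒<ᵇ
        ; ≤-trans; ≤-<-trans; ≤-pred; <⇒≤; ≮⇒≥; m≤m+n; m≤n⇒m≤1+n; n≤1+n; +-monoʳ-<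
        ; m+n∸m≡n; m+[n∸m]≡n; ∸-monoˡ-≤; n≡⌊n+n/2⌋; ⌊n/2⌋-mono )
open import Data.Product using (∃; _,_; proj₁; proj₂)
open import Data.Product.Properties using (≡-dec)
open import Data.Sum using (_⊎_; inj₁; inj₂; [_,_]′)
import Data.Sum as Sum
open import Function using (_∘_)
open import Function.Bundles using (Equivalence)
open import Relation.Binary.Definitions using (DecidableEquality)
open import Relation.Binary.PropositionalEquality
  using (refl; sym; trans; cong; cong₂; subst; _≢_; ≢-sym; module ≡-Reasoning)
open import Relation.Nullary using (yes; no)
open import Relation.Nullary.Decidable using (isYes; toWitness; fromWitness)

open MonoidSum +-0-commutativeMonoid using (sum; sum-permute)

-- Multiplicities and permutations

indicator : Bool → ℕ
indicator true  = 1
indicator false = 0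

weight-cong : ∀ {m} {y y′ : Tuple m} → (∀ i → y i ≡ y′ i) → weight y ≡ weight y′
weight-cong {zero}  _ = refl
weight-cong {suc m} {y} {y′} y≗y′ with y zero | y′ zero | y≗y′ zero
... | true  | .true  | refl = cong suc (weight-cong (y≗y′ ∘ suc))
... | false | .false | refl = weight-cong (y≗y′ ∘ suc)

weight≡sum : ∀ {m} (y : Tuple m) → weight y ≡ sum (indicator ∘ y)
weight≡sum {zero}  y = refl
weight≡sum {suc m} y with y zero
... | true  = cong suc (weight≡sum (y ∘ suc))
... | false = weight≡sum (y ∘ suc)

weight-permute : ∀ {m} (y : Tuple m) (σ : Permutation′ m) → weight (λ i → y (σ ⟨$⟩ʳ i)) ≡ weight y
weight-permute y σ = begin
  weight (λ i → y (σ ⟨$⟩ʳ i))            ≡⟨ weight≡sum (λ i → y (σ ⟨$⟩ʳ i)) ⟩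
  sum (λ i → indicator (y (σ ⟨$⟩ʳ i)))   ≡⟨ sum-permute (indicator ∘ y) σ ⟨
  sum (indicator ∘ y)                    ≡⟨ weight≡sum y ⟨
  weight y                               ∎
  where open ≡-Reasoning

weight-tail : ∀ {m} (y y′ : Tuple (suc m)) → y zero ≡ y′ zero → weight y ≡ weight y′ →
  weight (y ∘ suc) ≡ weight (y′ ∘ suc)
weight-tail y y′ y₀≡y′₀ eq with y zero | y′ zero | y₀≡y′₀
... | true  | .true  | refl = suc-injective eq
... | false | .false | refl = eq

weight+weight-not : ∀ {m} (y : Tuple m) → weight y + weight (not ∘ y) ≡ m
weight+weight-not {zero}  y = refl
weight+weight-not {suc m} y with y zero
... | true  = cong suc (weight+weight-not (y ∘ suc))
... | false = trans (+-suc _ _) (cong suc (weight+weight-not (y ∘ suc)))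

true⇒0<weight : ∀ {m} (y : Tuple m) (j : Fin m) → y j ≡ true → 0 < weight y
true⇒0<weight y zero    yj with y zero
... | true = z<s
true⇒0<weight y (suc j) yj with y zero
... | true  = z<s
... | false = true⇒0<weight (y ∘ suc) j yj

0<weight⇒true : ∀ {m} (y : Tuple m) → 0 < weight y → ∃ λ j → y j ≡ true
0<weight⇒true {suc m} y 0<w with y zero in y₀
... | true  = zero , y₀
... | false with j , yj ← 0<weight⇒true (y ∘ suc) 0<w = suc j , yj

module _ {a} {A : Set a} (_≟_ : DecidableEquality A) where

  multiplicity : ∀ {m} → (Fin m → A) → A → ℕ
  multiplicity xs x = weight (λ i → isYes (xs i ≟ x))

  occurs : ∀ {m} (xs : Fin m → A) (j : Fin m) → 0 < multiplicity xs (xs j)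
  occurs xs j = true⇒0<weight (λ i → isYes (xs i ≟ xs j)) j (Equivalence.to T-≡ (fromWitness refl))

  occurrence : ∀ {m} (xs : Fin m → A) x → 0 < multiplicity xs x → ∃ λ j → xs j ≡ x
  occurrence xs x 0<mult with j , hit ← 0<weight⇒true (λ i → isYes (xs i ≟ x)) 0<mult =
    j , toWitness (Equivalence.from T-≡ hit)

  -- Move an occurrence of ys zero to the front by a transposition, then recurse on the tails.
  permutation-of-equal-multiplicities : ∀ {m} (xs ys : Fin m → A) →
    (∀ x → multiplicity xs x ≡ multiplicity ys x) →
    Σ (Permutation′ m) λ σ → ∀ i → ys i ≡ xs (σ ⟨$⟩ʳ i)
  permutation-of-equal-multiplicities {zero}  xs ys _    = id , λ ()
  permutation-of-equal-multiplicities {suc m} xs ys same = lift₀ (proj₁ tails) ∘ₚ τ , matches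
    where
    found : ∃ λ j → xs j ≡ ys zero
    found = occurrence xs (ys zero) (subst (0 <_) (sym (same (ys zero))) (occurs ys zero))
    τ : Permutation′ (suc m)
    τ = transpose zero (proj₁ found)
    xs′ : Fin (suc m) → A
    xs′ i = xs (τ ⟨$⟩ʳ i)
    same-tails : ∀ x → multiplicity (xs′ ∘ suc) x ≡ multiplicity (ys ∘ suc) x
    same-tails x = weight-tail (λ i → isYes (xs′ i ≟ x)) (λ i → isYes (ys i ≟ x))
      (cong (λ z → isYes (z ≟ x)) (proj₂ found))
      (trans (weight-permute (λ i → isYes (xs i ≟ x)) τ) (same x))
    tails : Σ (Permutation′ m) λ ρ → ∀ i → ys (suc i) ≡ xs′ (suc (ρ ⟨$⟩ʳ i))
    tails = permutation-of-equal-multiplicities (xs′ ∘ suc) (ys ∘ suc) same-tails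
    matches : ∀ i → ys i ≡ xs′ (lift₀ (proj₁ tails) ⟨$⟩ʳ i)
    matches zero    = sym (proj₂ found)
    matches (suc i) = proj₂ tails i

permutation-of-equal-weight : ∀ {m} (y y′ : Tuple m) → weight y ≡ weight y′ →
  Σ (Permutation′ m) λ σ → ∀ i → y′ i ≡ y (σ ⟨$⟩ʳ i)
permutation-of-equal-weight y y′ eq = permutation-of-equal-multiplicities Bool._≟_ y y′ same
  where
  is-true : ∀ b → isYes (b Bool.≟ true) ≡ b
  is-true true  = refl
  is-true false = refl
  is-false : ∀ b → isYes (b Bool.≟ false) ≡ not b
  is-false true  = refl
  is-false false = refl
  same : ∀ b → multiplicity Bool._≟_ y b ≡ multiplicity Bool._≟_ y′ b
  same true  = trans (weight-cong (is-true ∘ y)) (trans eq (sym (weight-cong (is-true ∘ y′))))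
  same false = trans (weight-cong (is-false ∘ y)) (trans complements (sym (weight-cong (is-false ∘ y′))))
    where
    complements : weight (not ∘ y) ≡ weight (not ∘ y′)
    complements = +-cancelˡ-≡ (weight y) _ _
      (trans (weight+weight-not y) (sym (trans (cong (_+ _) eq) (weight+weight-not y′))))

weight-∘-cong : ∀ {m} {y y′ : Tuple m} → weight y ≡ weight y′ → (g : Bool → Bool) →
  weight (g ∘ y) ≡ weight (g ∘ y′)
weight-∘-cong {y = y} {y′} eq g with σ , y′≗yσ ← permutation-of-equal-weight y y′ eq =
  sym (trans (weight-cong (cong g ∘ y′≗yσ)) (weight-permute (g ∘ y) σ))

count : ℕ → (ℕ → Bool) → ℕ
count zero    h = 0
count (suc K) h = indicator (h 0) + count K (h ∘ suc)

weight≡count : ∀ K (h : ℕ → Bool) → weight {K} (λ i → h (toℕ i)) ≡ count K h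
weight≡count zero    h = refl
weight≡count (suc K) h with h 0
... | true  = cong suc (weight≡count K (h ∘ suc))
... | false = weight≡count K (h ∘ suc)

count-cong : ∀ K {h h′ : ℕ → Bool} → (∀ v → v < K → h v ≡ h′ v) → count K h ≡ count K h′
count-cong zero    _    = refl
count-cong (suc K) h≗h′ =
  cong₂ (λ b c → indicator b + c) (h≗h′ 0 z<s) (count-cong K (λ v → h≗h′ (suc v) ∘ s<s))

count-+ : ∀ a b h → count (a + b) h ≡ count a h + count b (λ v → h (a + v))
count-+ zero    b h = refl
count-+ (suc a) b h =
  trans (cong (indicator (h 0) +_) (count-+ a b (h ∘ suc))) (sym (+-assoc (indicator (h 0)) _ _))

count-false : ∀ K {h} → (∀ v → v < K → h v ≡ false) → count K h ≡ 0
count-false K h≗false = trans (count-cong K h≗false) (all-false K)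
  where
  all-false : ∀ K → count K (λ _ → false) ≡ 0
  all-false zero    = refl
  all-false (suc K) = all-false K

count-true : ∀ K {h} → (∀ v → v < K → h v ≡ true) → count K h ≡ K
count-true K h≗true = trans (count-cong K h≗true) (all-true K)
  where
  all-true : ∀ K → count K (λ _ → true) ≡ K
  all-true zero    = refl
  all-true (suc K) = cong suc (all-true K)

count-≤ : ∀ K h → count K h ≤ K
count-≤ zero    h = z≤n
count-≤ (suc K) h with h 0
... | true  = s≤s (count-≤ K (h ∘ suc))
... | false = m≤n⇒m≤1+n (count-≤ K (h ∘ suc))

count-∘-cong : ∀ K {h h′ : ℕ → Bool} → count K h ≡ count K h′ → (g : Bool → Bool) →
  count K (g ∘ h) ≡ count K (g ∘ h′)
count-∘-cong K {h} {h′} eq g = begin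
  count K (g ∘ h)                    ≡⟨ weight≡count K (g ∘ h) ⟨
  weight {K} (λ i → g (h (toℕ i)))   ≡⟨ weight-∘-cong {K} {λ i → h (toℕ i)} weight≈ g ⟩
  weight {K} (λ i → g (h′ (toℕ i)))  ≡⟨ weight≡count K (g ∘ h′) ⟩
  count K (g ∘ h′)                   ∎
  where
  open ≡-Reasoning
  weight≈ : weight {K} (λ i → h (toℕ i)) ≡ weight {K} (λ i → h′ (toℕ i))
  weight≈ = trans (weight≡count K h) (trans eq (sym (weight≡count K h′)))

count-half : ∀ K h → count (2 * K) (h ∘ ⌊_/2⌋) ≡ count K h + count K h
count-half zero    h = refl
count-half (suc K) h = begin
  count (2 * suc K) (h ∘ ⌊_/2⌋)                       ≡⟨ cong (λ m → count m (h ∘ ⌊_/2⌋)) (*-suc 2 K) ⟩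
  i + (i + count (2 * K) (h ∘ suc ∘ ⌊_/2⌋))           ≡⟨ cong (λ m → i + (i + m)) (count-half K (h ∘ suc)) ⟩
  i + (i + (count K (h ∘ suc) + count K (h ∘ suc)))   ≡⟨ +-assoc i i _ ⟨
  (i + i) + (count K (h ∘ suc) + count K (h ∘ suc))   ≡⟨ interchange +-commutativeSemigroup i i _ _ ⟩
  count (suc K) h + count (suc K) h                    ∎
  where
  open ≡-Reasoning
  i : ℕ
  i = indicator (h 0)

<ᵇ-true : ∀ {m n} → m < n → (m <ᵇ n) ≡ true
<ᵇ-true m<n = Equivalence.to T-≡ (<⇒<ᵇ m<n)

<ᵇ-false : ∀ {m n} → n ≤ m → (m <ᵇ n) ≡ false
<ᵇ-false {m}     {zero}  _         = refl
<ᵇ-false {suc m} {suc n} (s≤s n≤m) = <ᵇ-false n≤m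

+-<ᵇ : ∀ a m n → (a + m <ᵇ a + n) ≡ (m <ᵇ n)
+-<ᵇ zero    m n = refl
+-<ᵇ (suc a) m n = +-<ᵇ a m n

count-<ᵇ : ∀ K t → t ≤ K → count K (_<ᵇ t) ≡ t
count-<ᵇ K       zero    _         = count-false K (λ _ _ → refl)
count-<ᵇ (suc K) (suc t) (s≤s t≤K) = cong suc (count-<ᵇ K t t≤K)

-- Circulants

-- For w < 2L, window L t w holds iff (w mod L) < t.
window : ℕ → ℕ → ℕ → Bool
window L t w = (w <ᵇ t) ∨ (not (w <ᵇ L) ∧ (w <ᵇ L + t))

window-below : ∀ {L t w} → w < L → window L t w ≡ (w <ᵇ t)
window-below {L} {t} {w} w<L rewrite <ᵇ-true w<L = ∨-identityʳ (w <ᵇ t)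

window-periodic : ∀ {L t w} → t ≤ L → w < L → window L t (L + w) ≡ window L t w
window-periodic {L} {t} {w} t≤L w<L
  rewrite <ᵇ-false {L + w} {t} (≤-trans t≤L (m≤m+n L w))
        | <ᵇ-false {L + w} {L} (m≤m+n L w)
        | +-<ᵇ L w t
        = sym (window-below w<L)

-- Shifting the window by one drops position c and gains position c + L, which window cannot tell apart.
count-window : ∀ {L t} c → t ≤ L → c ≤ L → count L (λ v → window L t (c + v)) ≡ t
count-window {L} {t} zero    t≤L _   = trans (count-cong L (λ v → window-below)) (count-<ᵇ L t t≤L)
count-window {L} {t} (suc c) t≤L c<L = +-cancelˡ-≡ (count 1 W) _ _ (begin
  count 1 W + count L (λ v → window L t (suc c + v))
    ≡⟨ cong (count 1 W +_) (count-cong L (λ v _ → cong (window L t) (sym (+-suc c v)))) ⟩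
  count 1 W + count L (λ v → W (suc v))   ≡⟨ count-+ 1 L W ⟨
  count (suc L) W                         ≡⟨ cong (λ K → count K W) (+-comm 1 L) ⟩
  count (L + 1) W                         ≡⟨ count-+ L 1 W ⟩
  count L W + count 1 (λ v → W (L + v))   ≡⟨ cong₂ _+_ (count-window c t≤L (<⇒≤ c<L)) wrap ⟩
  t + count 1 W                           ≡⟨ +-comm t _ ⟩
  count 1 W + t                           ∎)
  where
  open ≡-Reasoning
  W : ℕ → Bool
  W v = window L t (c + v)
  wrap : count 1 (λ v → W (L + v)) ≡ count 1 W
  wrap = count-cong 1 {λ v → W (L + v)} {W} λ where
    zero _ → begin
      window L t (c + (L + 0))  ≡⟨ cong (window L t) (trans (cong (c +_) (+-identityʳ L)) (+-comm c L)) ⟩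
      window L t (L + c)        ≡⟨ window-periodic t≤L c<L ⟩
      window L t c              ≡⟨ cong (window L t) (+-identityʳ c) ⟨
      window L t (c + 0)        ∎
    (suc _) (s≤s ())

-- A circulant of order L with t ones in each row and column, placed in rows r … r + L - 1.
block : ℕ → ℕ → ℕ → ℕ → ℕ → Bool
block r L t v c = not (v <ᵇ r) ∧ window L t ((v ∸ r) + c)

block-above : ∀ {r L t v c} → v < r → block r L t v c ≡ false
block-above v<r rewrite <ᵇ-true v<r = refl

block-shift : ∀ r {L t} w c → block r L t (r + w) c ≡ window L t (w + c)
block-shift r w c rewrite <ᵇ-false {r + w} {r} (m≤m+n r w) | m+n∸m≡n r w = refl

count-block-row : ∀ {r L t v} → t ≤ L → r ≤ v → v ≤ r + L → count L (block r L t v) ≡ t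
count-block-row {r} {L} {t} {v} t≤L r≤v v≤r+L rewrite <ᵇ-false r≤v =
  count-window (v ∸ r) t≤L (subst (v ∸ r ≤_) (m+n∸m≡n r L) (∸-monoˡ-≤ r v≤r+L))

count-block-column : ∀ r {L t c} → t ≤ L → c ≤ L → count (r + L) (λ v → block r L t v c) ≡ t
count-block-column r {L} {t} {c} t≤L c≤L = begin
  count (r + L) (λ v → block r L t v c)
    ≡⟨ count-+ r L _ ⟩
  count r (λ v → block r L t v c) + count L (λ w → block r L t (r + w) c)
    ≡⟨ cong₂ _+_ (count-false r (λ v → block-above {r} {L} {t} {v} {c}))
                 (count-cong L (λ w _ → trans (block-shift r {L} {t} w c) (cong (window L t) (+-comm w c)))) ⟩
  count L (λ w → window L t (c + w))
    ≡⟨ count-window c t≤L c≤L ⟩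
  t ∎
  where open ≡-Reasoning

interleave : (ℕ → Bool) → (ℕ → Bool) → ℕ → Bool
interleave e o J = if J % 2 ≡ᵇ 0 then e ⌊ J /2⌋ else o ⌊ J /2⌋

count-interleave : ∀ n (P : ℕ → Bool → Bool) e o →
  count (suc (2 * n)) (λ J → P (J % 2) (interleave e o J)) ≡
  count (suc n) (P 0 ∘ e) + count n (P 1 ∘ o)
count-interleave zero    P e o = sym (+-identityʳ _)
count-interleave (suc n) P e o = begin
  count (suc (2 * suc n)) g                              ≡⟨ cong (λ L → count (suc L) g) (*-suc 2 n) ⟩
  count (2 + suc (2 * n)) g                              ≡⟨ count-+ 2 (suc (2 * n)) g ⟩
  count 2 g + count (suc (2 * n)) (λ J → g (2 + J))      ≡⟨ cong₂ _+_ (count-+ 1 1 g)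
                                                              (count-interleave n P (e ∘ suc) (o ∘ suc)) ⟩
  (count 1 g + count 1 (g ∘ suc)) + (count (suc n) (P 0 ∘ e ∘ suc) + count n (P 1 ∘ o ∘ suc))
    ≡⟨ interchange +-commutativeSemigroup (count 1 g) (count 1 (g ∘ suc)) _ _ ⟩
  (count 1 g + count (suc n) (P 0 ∘ e ∘ suc)) + (count 1 (g ∘ suc) + count n (P 1 ∘ o ∘ suc))
    ≡⟨ cong₂ _+_ (count-+ 1 (suc n) (P 0 ∘ e)) (count-+ 1 n (P 1 ∘ o)) ⟨
  count (suc (suc n)) (P 0 ∘ e) + count (suc n) (P 1 ∘ o) ∎
  where
  open ≡-Reasoning
  g : ℕ → Bool
  g J = P (J % 2) (interleave e o J)

-- Colour position j by its parity and its bit: equal block counts give equal colour multiplicities.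
interleave-permutation : ∀ n {e e′ o o′} → count (suc n) e ≡ count (suc n) e′ → count n o ≡ count n o′ →
  Σ (Permutation′ (suc (2 * n))) λ σ → ParityPreserving σ ×
    (∀ j → interleave e′ o′ (toℕ j) ≡ interleave e o (toℕ (σ ⟨$⟩ʳ j)))
interleave-permutation n {e} {e′} {o} {o′} e≈e′ o≈o′ =
  proj₁ permuted , (λ j → sym (cong proj₁ (proj₂ permuted j))) , (λ j → cong proj₂ (proj₂ permuted j))
  where
  _≟_ : DecidableEquality (ℕ × Bool)
  _≟_ = ≡-dec Nat._≟_ Bool._≟_
  colouring : (ℕ → Bool) → (ℕ → Bool) → Fin (suc (2 * n)) → ℕ × Bool
  colouring e o j = toℕ j % 2 , interleave e o (toℕ j)
  same : ∀ x → multiplicity _≟_ (colouring e o) x ≡ multiplicity _≟_ (colouring e′ o′) x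
  same x = begin
    multiplicity _≟_ (colouring e o) x
      ≡⟨ weight≡count (suc (2 * n)) (λ J → P (J % 2) (interleave e o J)) ⟩
    count (suc (2 * n)) (λ J → P (J % 2) (interleave e o J))
      ≡⟨ count-interleave n P e o ⟩
    count (suc n) (P 0 ∘ e) + count n (P 1 ∘ o)
      ≡⟨ cong₂ _+_ (count-∘-cong (suc n) {e} {e′} e≈e′ (P 0)) (count-∘-cong n {o} {o′} o≈o′ (P 1)) ⟩
    count (suc n) (P 0 ∘ e′) + count n (P 1 ∘ o′)
      ≡⟨ count-interleave n P e′ o′ ⟨
    count (suc (2 * n)) (λ J → P (J % 2) (interleave e′ o′ J))
      ≡⟨ weight≡count (suc (2 * n)) (λ J → P (J % 2) (interleave e′ o′ J)) ⟨
    multiplicity _≟_ (colouring e′ o′) x ∎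
    where
    open ≡-Reasoning
    P : ℕ → Bool → Bool
    P p b = isYes ((p , b) ≟ x)
  permuted : Σ (Permutation′ (suc (2 * n))) λ σ → ∀ j → colouring e′ o′ j ≡ colouring e o (σ ⟨$⟩ʳ j)
  permuted = permutation-of-equal-multiplicities _≟_ (colouring e o) (colouring e′ o′) same

even-or-odd : ∀ J → (∃ λ c → J ≡ 2 * c) ⊎ (∃ λ c → J ≡ suc (2 * c))
even-or-odd zero = inj₁ (0 , refl)
even-or-odd (suc J) with even-or-odd J
... | inj₁ (c , J≡2c)   = inj₂ (c , cong suc J≡2c)
... | inj₂ (c , J≡2c+1) = inj₁ (suc c , trans (cong suc J≡2c+1) (sym (*-suc 2 c)))

interleave-even : ∀ e o c → interleave e o (2 * c) ≡ e c
interleave-even e o zero    = refl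
interleave-even e o (suc c) =
  trans (cong (interleave e o) (*-suc 2 c)) (interleave-even (e ∘ suc) (o ∘ suc) c)

interleave-odd : ∀ e o c → interleave e o (suc (2 * c)) ≡ o c
interleave-odd e o zero    = refl
interleave-odd e o (suc c) =
  trans (cong (interleave e o ∘ suc) (*-suc 2 c)) (interleave-odd (e ∘ suc) (o ∘ suc) c)

interleave-at : ∀ n J → J < suc (2 * n) →
  (∃ λ c → c ≤ n × ∀ e o → interleave e o J ≡ e c) ⊎
  (∃ λ c → c < n × ∀ e o → interleave e o J ≡ o c)
interleave-at n J J<2n+1 with even-or-odd J
... | inj₁ (c , refl) = inj₁ (c , *-cancelˡ-≤ 2 (≤-pred J<2n+1) , λ e o → interleave-even e o c)
... | inj₂ (c , refl) = inj₂ (c , *-cancelˡ-< 2 c n (≤-pred J<2n+1) , λ e o → interleave-odd e o c)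
-- The three matrices

-- The odd columns of a (n + 1) × (2n + 1) matrix whose even columns form the circulant
-- window (suc n) t (v + c): entry v c sits in row v and column 2c + 1.
record Configuration (n t d a b : ℕ) : Set where
  field
    entry      : ℕ → ℕ → Bool
    row-weight : ∀ v → v ≤ n → count n (entry v) ≡ a ⊎ count n (entry v) ≡ b
    column     : ∀ c → c < n →
                 count (suc n) (λ v → entry v c) ≡ t ⊎ (∀ v → v ≤ n → entry v c ≡ (v <ᵇ d))

initial : ∀ {k} → ℕ → Tuple k
initial d i = toℕ i <ᵇ d

canonical : ∀ n → ℕ → ℕ → Tuple (suc (2 * n))
canonical n s r j = interleave (_<ᵇ s) (_<ᵇ r) (toℕ j)

NAE-nonconstant : ∀ {k} {y : Tuple k} u → (∀ i → y i ≡ u) → ¬ NAE k y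
NAE-nonconstant false y≡false (not-all-false , _) = not-all-false y≡false
NAE-nonconstant true  y≡true  (_ , not-all-true)  = not-all-true y≡true

module Matrix {n t d a b : ℕ} (t≤n : t ≤ n) (C : Configuration n t d a b) where

  open Configuration C

  t≤1+n : t ≤ suc n
  t≤1+n = m≤n⇒m≤1+n t≤n

  circulant : ℕ → ℕ → Bool
  circulant v c = window (suc n) t (v + c)

  row : Fin (suc n) → ℕ → Bool
  row i = interleave (circulant (toℕ i)) (entry (toℕ i))

  odd-weight : Fin (suc n) → ℕ
  odd-weight i = count n (entry (toℕ i))

  odd-weight-cases : ∀ i → odd-weight i ≡ a ⊎ odd-weight i ≡ b
  odd-weight-cases i = row-weight (toℕ i) (≤-pred (toℕ<n i))

  alignment : ∀ i → Σ (Permutation′ (suc (2 * n))) λ σ → ParityPreserving σ ×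
    (∀ j → row i (toℕ j) ≡ canonical n t (odd-weight i) (σ ⟨$⟩ʳ j))
  alignment i = interleave-permutation n {_<ᵇ t} {circulant (toℕ i)} {_<ᵇ odd-weight i} {entry (toℕ i)}
    (trans (count-<ᵇ (suc n) t t≤1+n) (sym (count-window (toℕ i) t≤1+n (<⇒≤ (toℕ<n i)))))
    (count-<ᵇ n (odd-weight i) (count-≤ n (entry (toℕ i))))

  matrix : Fin (suc n) → Fin (suc (2 * n)) → Bool
  matrix i j = canonical n t (odd-weight i) (proj₁ (alignment i) ⟨$⟩ʳ j)

  matrix-entry : ∀ i j → matrix i j ≡ row i (toℕ j)
  matrix-entry i j = sym (proj₂ (proj₂ (alignment i)) j)

  even-column : ∀ j c → c ≤ n → (∀ i → row i (toℕ j) ≡ circulant (toℕ i) c) →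
    weight (λ i → matrix i j) ≡ t
  even-column j c c≤n at-c = begin
    weight (λ i → matrix i j)                        ≡⟨ weight-cong (λ i → trans (matrix-entry i j) (at-c i)) ⟩
    weight {suc n} (λ i → circulant (toℕ i) c)       ≡⟨ weight≡count (suc n) (λ v → circulant v c) ⟩
    count (suc n) (λ v → window (suc n) t (v + c))
      ≡⟨ count-cong (suc n) (λ v _ → cong (window (suc n) t) (+-comm v c)) ⟩
    count (suc n) (λ v → window (suc n) t (c + v))   ≡⟨ count-window c t≤1+n (m≤n⇒m≤1+n c≤n) ⟩
    t                                                ∎
    where open ≡-Reasoning

  odd-column : ∀ j c → c < n → (∀ i → row i (toℕ j) ≡ entry (toℕ i) c) →
    I∪ (suc n) t (initial d) (λ i → matrix i j)
  odd-column j c c<n at-c = Sum.map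
    (λ weight≡t → trans (weight-cong (λ i → trans (matrix-entry i j) (at-c i)))
                        (trans (weight≡count (suc n) (λ v → entry v c)) weight≡t))
    (λ ≗initial i → trans (matrix-entry i j) (trans (at-c i) (≗initial (toℕ i) (≤-pred (toℕ<n i)))))
    (column c c<n)

  columns-in-relation : ∀ j → I∪ (suc n) t (initial d) (λ i → matrix i j)
  columns-in-relation j =
    [ (λ (c , c≤n , even) → inj₁ (even-column j c c≤n (λ i → even (circulant (toℕ i)) (entry (toℕ i)))))
    , (λ (c , c<n , odd)  → odd-column j c c<n (λ i → odd (circulant (toℕ i)) (entry (toℕ i))))
    ]′ (interleave-at n (toℕ j) (toℕ<n j))

-- Each row of the matrix is a parity-preserving permutation of a canonical tuple with odd weight
-- a or b, so if f agreed on those two canonical tuples it would be constant on the rows.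
configuration-separates : ∀ {n t d a b} {f : Op (suc (2 * n))} →
  IsPolymorphism (I∪ (suc n) t (initial d)) (NAE (suc n)) f → TwoBlockSymmetric n f → t ≤ n →
  Configuration n t d a b → f (canonical n t a) ≢ f (canonical n t b)
configuration-separates {n} {t} {a = a} {b} {f} polymorphism symmetric t≤n C fa≡fb =
  NAE-nonconstant (f (canonical n t a)) row-value (polymorphism matrix columns-in-relation)
  where
  open Matrix t≤n C
  by-weight : ∀ {w} → w ≡ a ⊎ w ≡ b → f (canonical n t w) ≡ f (canonical n t a)
  by-weight (inj₁ refl) = refl
  by-weight (inj₂ refl) = sym fa≡fb
  row-value : ∀ i → f (matrix i) ≡ f (canonical n t a)
  row-value i =
    trans (symmetric (proj₁ (alignment i)) (proj₁ (proj₂ (alignment i))) (canonical n t (odd-weight i)))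
          (by-weight (odd-weight-cases i))

shifted-circulant : ∀ {n t d} → t ≤ n → Configuration n t d t 0
shifted-circulant {n} {t} t≤n = record
  { entry      = block 1 n t
  ; row-weight = λ where
      zero    _   → inj₂ (count-false n (λ c _ → block-above {1} {n} {t} {0} {c} z<s))
      (suc v) v<n → inj₁ (count-block-row t≤n (s≤s z≤n) (m≤n⇒m≤1+n v<n))
  ; column     = λ c c<n → inj₁ (count-block-column 1 t≤n (<⇒≤ c<n))
  }

doubled-circulant : ∀ {K t d} → t + t ≤ 2 * K → Configuration (2 * K) t d (t + t) 0
doubled-circulant {K} {t} t+t≤2K = record
  { entry      = entry
  ; row-weight = row-weight
  ; column     = λ c c<2K → inj₁ (trans (cong (λ m → count (suc m) (λ v → entry v c)) 2K≡K+K)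
                                        (count-block-column (suc K) t≤K (half≤K c<2K)))
  }
  where
  2K≡K+K : 2 * K ≡ K + K
  2K≡K+K = cong (K +_) (+-identityʳ K)
  t≤K : t ≤ K
  t≤K = *-cancelˡ-≤ 2 (subst (_≤ 2 * K) (cong (t +_) (sym (+-identityʳ t))) t+t≤2K)
  half≤K : ∀ {c} → c < 2 * K → ⌊ c /2⌋ ≤ K
  half≤K {c} c<2K =
    subst (⌊ c /2⌋ ≤_) (sym (n≡⌊n+n/2⌋ K)) (⌊n/2⌋-mono (subst (c ≤_) 2K≡K+K (<⇒≤ c<2K)))
  entry : ℕ → ℕ → Bool
  entry v c = block (suc K) K t v ⌊ c /2⌋
  row-weight : ∀ v → v ≤ 2 * K → count (2 * K) (entry v) ≡ t + t ⊎ count (2 * K) (entry v) ≡ 0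
  row-weight v v≤2K with v <? suc K
  ... | yes v≤K = inj₂ (count-false (2 * K) (λ c _ → block-above {suc K} {K} {t} {v} {⌊ c /2⌋} v≤K))
  ... | no  v≰K = inj₁ (trans (count-half K (block (suc K) K t v)) (cong₂ _+_ row row))
    where
    row : count K (block (suc K) K t v) ≡ t
    row = count-block-row t≤K (≮⇒≥ v≰K)
            (≤-trans v≤2K (subst (_≤ suc K + K) (sym 2K≡K+K) (n≤1+n (K + K))))

bordered-circulant : ∀ {n t d} → t + t ≤ n → t < d → Configuration n t d t (t + t)
bordered-circulant {n} {t} {d} t+t≤n t<d = record
  { entry      = entry
  ; row-weight = row-weight
  ; column     = column
  }
  where
  q : ℕ
  q = n ∸ t
  n≡t+q : n ≡ t + q
  n≡t+q = sym (m+[n∸m]≡n (≤-trans (m≤m+n t t) t+t≤n))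
  t≤q : t ≤ q
  t≤q = subst (_≤ q) (m+n∸m≡n t t) (∸-monoˡ-≤ t t+t≤n)
  entry : ℕ → ℕ → Bool
  entry v c = if c <ᵇ t then v <ᵇ d else block (suc t) q t v (c ∸ t)
  entry-left : ∀ {v c} → c < t → entry v c ≡ (v <ᵇ d)
  entry-left c<t rewrite <ᵇ-true c<t = refl
  entry-right : ∀ {v c} → t ≤ c → entry v c ≡ block (suc t) q t v (c ∸ t)
  entry-right t≤c rewrite <ᵇ-false t≤c = refl
  row-split : ∀ v → count n (entry v) ≡ count t (λ _ → v <ᵇ d) + count q (block (suc t) q t v)
  row-split v = begin
    count n (entry v)                                         ≡⟨ cong (λ m → count m (entry v)) n≡t+q ⟩
    count (t + q) (entry v)                                   ≡⟨ count-+ t q (entry v) ⟩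
    count t (entry v) + count q (λ w → entry v (t + w))
      ≡⟨ cong₂ _+_ (count-cong t (λ c → entry-left))
                   (count-cong q (λ w _ → trans (entry-right (m≤m+n t w))
                                                (cong (block (suc t) q t v) (m+n∸m≡n t w)))) ⟩
    count t (λ _ → v <ᵇ d) + count q (block (suc t) q t v)    ∎
    where open ≡-Reasoning
  lower-rows : ∀ {v} → t < v → v ≤ n → count q (block (suc t) q t v) ≡ t
  lower-rows t<v v≤n =
    count-block-row t≤q t<v (≤-trans v≤n (subst (_≤ suc t + q) (sym n≡t+q) (n≤1+n (t + q))))
  row-weight : ∀ v → v ≤ n → count n (entry v) ≡ t ⊎ count n (entry v) ≡ t + t
  row-weight v v≤n with v <? suc t | v <? d
  ... | yes v≤t | _       = inj₁ (trans (row-split v) (trans (cong₂ _+_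
        (count-true t (λ _ _ → <ᵇ-true (≤-<-trans (≤-pred v≤t) t<d)))
        (count-false q (λ c _ → block-above {suc t} {q} {t} {v} {c} v≤t))) (+-identityʳ t)))
  ... | no v≰t  | yes v<d = inj₂ (trans (row-split v)
        (cong₂ _+_ (count-true t (λ _ _ → <ᵇ-true v<d)) (lower-rows (≮⇒≥ v≰t) v≤n)))
  ... | no v≰t  | no v≮d  = inj₁ (trans (row-split v)
        (cong₂ _+_ (count-false t (λ _ _ → <ᵇ-false (≮⇒≥ v≮d))) (lower-rows (≮⇒≥ v≰t) v≤n)))
  column : ∀ c → c < n → count (suc n) (λ v → entry v c) ≡ t ⊎ (∀ v → v ≤ n → entry v c ≡ (v <ᵇ d))
  column c c<n with c <? t
  ... | yes c<t = inj₂ (λ v _ → entry-left c<t)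
  ... | no  c≮t = inj₁ (begin
    count (suc n) (λ v → entry v c)
      ≡⟨ cong (λ m → count (suc m) (λ v → entry v c)) n≡t+q ⟩
    count (suc t + q) (λ v → entry v c)
      ≡⟨ count-cong (suc t + q) (λ v _ → entry-right {v} (≮⇒≥ c≮t)) ⟩
    count (suc t + q) (λ v → block (suc t) q t v (c ∸ t))
      ≡⟨ count-block-column (suc t) t≤q (∸-monoˡ-≤ t (<⇒≤ c<n)) ⟩
    t ∎)
    where open ≡-Reasoning

-- Moving x to an initial segment

NAE-reindex : ∀ {k} {y : Tuple k} (π : Fin k → Fin k) → NAE k (λ i → y (π i)) → NAE k y
NAE-reindex π (not-all-false , not-all-true) =
  (λ y≡false → not-all-false (λ i → y≡false (π i))) , (λ y≡true → not-all-true (λ i → y≡true (π i)))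

polymorphism-permute : ∀ {k t m} {x x′ : Tuple k} {f : Op m} (σ : Permutation′ k) →
  (∀ i → x′ i ≡ x (σ ⟨$⟩ʳ i)) →
  IsPolymorphism (I∪ k t x) (NAE k) f → IsPolymorphism (I∪ k t x′) (NAE k) f
polymorphism-permute {x = x} σ x′≗xσ polymorphism M columns =
  NAE-reindex (σ ⟨$⟩ˡ_) (polymorphism (λ i → M (σ ⟨$⟩ˡ i)) permuted-columns)
  where
  permuted-columns : ∀ j → I∪ _ _ x (λ i → M (σ ⟨$⟩ˡ i) j)
  permuted-columns j with columns j
  ... | inj₁ weight≡t = inj₁ (trans (weight-permute (λ i → M i j) (flip σ)) weight≡t)
  ... | inj₂ ≗x′      =
    inj₂ (λ i → trans (≗x′ (σ ⟨$⟩ˡ i)) (trans (x′≗xσ (σ ⟨$⟩ˡ i)) (cong x (inverseʳ σ))))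

weight-initial : ∀ {k d} → d ≤ k → weight (initial {k} d) ≡ d
weight-initial {k} {d} d≤k = trans (weight≡count k (_<ᵇ d)) (count-<ᵇ k d d≤k)

polymorphism-initial : ∀ {k t d m} {x : Tuple k} {f : Op m} → weight x ≡ d → d ≤ k →
  IsPolymorphism (I∪ k t x) (NAE k) f → IsPolymorphism (I∪ k t (initial d)) (NAE k) f
polymorphism-initial {d = d} {x = x} {f} weight-x≡d d≤k with
  permutation-of-equal-weight x (initial d) (trans weight-x≡d (sym (weight-initial d≤k)))
... | σ , initial≗xσ = polymorphism-permute {f = f} σ initial≗xσ

no-three-distinct-Bools : (x y z : Bool) → x ≢ y → y ≢ z → x ≢ z → ⊥
no-three-distinct-Bools false false _     x≢y _   _   = x≢y refl
no-three-distinct-Bools true  true  _     x≢y _   _   = x≢y refl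
no-three-distinct-Bools false true  false _   _   x≢z = x≢z refl
no-three-distinct-Bools true  false true  _   _   x≢z = x≢z refl
no-three-distinct-Bools false true  true  _   y≢z _   = y≢z refl
no-three-distinct-Bools true  false false _   y≢z _   = y≢z refl

no-blockSymmetric-polymorphism : ∀ K {t d} → t + t ≤ 2 * K → t < d → (f : Op (suc (2 * (2 * K)))) →
  IsPolymorphism (I∪ (suc (2 * K)) t (initial d)) (NAE (suc (2 * K))) f → ¬ TwoBlockSymmetric (2 * K) f
no-blockSymmetric-polymorphism K {t} {d} t+t≤2K t<d f polymorphism symmetric =
  no-three-distinct-Bools (g 0) (g t) (g (t + t))
    (≢-sym (separates (shifted-circulant t≤2K)))
    (separates (bordered-circulant t+t≤2K t<d))
    (≢-sym (separates (doubled-circulant {K} t+t≤2K)))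
  where
  g : ℕ → Bool
  g b = f (canonical (2 * K) t b)
  t≤2K : t ≤ 2 * K
  t≤2K = ≤-trans (m≤m+n t t) t+t≤2K
  separates : ∀ {a b} → Configuration (2 * K) t d a b → g a ≢ g b
  separates = configuration-separates polymorphism symmetric t≤2K

odd⇒suc-double : ∀ {k} → Odd k → ∃ λ K → k ≡ suc (2 * K)
odd⇒suc-double {k} odd with even-or-odd k
... | inj₁ (c , k≡2c) = ⊥-elim (odd (divides c (trans k≡2c (*-comm 2 c))))
... | inj₂ k≡2K+1     = k≡2K+1

proposition4p6 : (k t d : ℕ) → 3 ≤ k → 1 ≤ t → t < k → t < d → d < k → d + t ≤ k →
    Odd k → Even t → Even d → (x : Tuple k) → weight x ≡ d →
    ∃[ n ] ¬ (Σ (Op (suc (2 * n))) λ f →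
      IsPolymorphism (I∪ k t x) (NAE k) f × TwoBlockSymmetric n f)
proposition4p6 k t d _ _ _ t<d d<k d+t≤k odd-k _ _ x weight-x≡d with odd⇒suc-double odd-k
... | K , refl = 2 * K , λ (f , polymorphism , symmetric) →
  no-blockSymmetric-polymorphism K t+t≤2K t<d f
    (polymorphism-initial {f = f} weight-x≡d (<⇒≤ d<k) polymorphism) symmetric
  where
  t+t≤2K : t + t ≤ 2 * K
  t+t≤2K = ≤-pred (≤-trans (+-monoʳ-< t t<d) (subst (_≤ suc (2 * K)) (+-comm d t) d+t≤k))
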